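{- Let $\Sigma_1$ and $\Sigma_2$ be signed simple graphs with chromatic numbers $\chi_1,\chi_2$ and maximum deficiencies $M_1,M_2$, respectively. If $\chi_1 \geq \chi_1 + \chi_2 - M_1 - M_2$, then $\chi(\Sigma_1 \vee_+ \Sigma_2) = \chi_1$.
   Context: A signed simple graph is $\Sigma=(V,E,\sigma)$ where $(V,E)$ is a graph with no loops and no multiple edges and $\sigma:E\to\{+,-\}$. A proper coloration of $\Sigma$ is a function $\kappa: V \to \{\pm1,\ldots,\pm k,0\}$ such that for every edge $e$ with endpoints $a,b$, $\kappa(a)\neq \sigma(e)\kappa(b)$. Color sets are $\{\pm1,\ldots,\pm k\}$ (size $2k$) or $\{\pm1,\ldots,\pm k,0\}$ (size $2k+1$). The chromatic number $\chi(\Sigma)$ is the smallest size of a color set with which $\Sigma$ can be properly colored. A coloration is minimal if it is proper and takes values in a color set of size $\chi(\Sigma)$. The deficiency of a coloration is the number of colors of its color set not used by it; the maximum deficiency $\operatorname{M}(\Sigma)$ is the maximum deficiency over all minimal proper colorations of $\Sigma$. The all-positive join $\Sigma_1\vee_+\Sigma_2$ is the signed graph on the disjoint union $V(\Sigma_1)\cup V(\Sigma_2)$ whose edges are those of $\Sigma_1$ and $\Sigma_2$ (with their signs) together with a positive edge $vw$ for every $v\in V(\Sigma_1)$, $w\in V(\Sigma_2)$. -}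

module Defs where

open import Data.Nat as ℕ using (ℕ; zero; suc; _<_; _≤_; _/_; _%_)
open import Data.Integer as ℤ using (ℤ; +_; -_; _≟_)
open import Data.Fin using (Fin; splitAt)
open import Data.Fin.Properties using (any?)
open import Data.List using (List; []; _∷_; _++_; length; filter)
open import Data.List.Membership.Propositional using (_∈_)
open import Data.Maybe using (Maybe; just; nothing)
open import Data.Product using (Σ; _×_; _,_; ∃)
open import Data.Sum using (inj₁; inj₂)
open import Relation.Nullary using (¬_)
open import Relation.Nullary.Decidable using (¬?)
open import Relation.Binary.PropositionalEquality using (_≡_; _≢_; refl)

data Sign : Set where
  pos neg : Sign

act : Sign → ℤ → ℤ
act pos c = c
act neg c = - c

-- Symmetric (undirected), irreflexive (no loops); multiple edges are
-- impossible by construction.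
record SignedGraph (n : ℕ) : Set where
  field
    edge  : Fin n → Fin n → Maybe Sign
    symm  : ∀ a b → edge a b ≡ edge b a
    loopless : ∀ a → edge a a ≡ nothing
open SignedGraph public

-- the colour set of size s:
--   s = 2k   : {±1,…,±k}
--   s = 2k+1 : {±1,…,±k,0}
pairs : ℕ → List ℤ
pairs zero    = []
pairs (suc k) = + suc k ∷ - (+ suc k) ∷ pairs k

zeroPart : ℕ → List ℤ
zeroPart zero    = []
zeroPart (suc _) = + 0 ∷ []

palette : ℕ → List ℤ
palette s = zeroPart (s % 2) ++ pairs (s / 2)

Proper : ∀ {n} → SignedGraph n → ℕ → (Fin n → ℤ) → Set
Proper {n} G s κ =
  (∀ v → κ v ∈ palette s) ×
  (∀ a b σ → edge G a b ≡ just σ → κ a ≢ act σ (κ b))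

Colorable : ∀ {n} → SignedGraph n → ℕ → Set
Colorable G s = ∃ λ κ → Proper G s κ

IsChromaticNumber : ∀ {n} → SignedGraph n → ℕ → Set
IsChromaticNumber G χ = Colorable G χ × (∀ s → s < χ → ¬ Colorable G s)

deficiency : ∀ {n} → ℕ → (Fin n → ℤ) → ℕ
deficiency s κ = length (filter (λ c → ¬? (any? (λ v → κ v ≟ c))) (palette s))

IsMaxDeficiency : ∀ {n} → SignedGraph n → ℕ → ℕ → Set
IsMaxDeficiency G χ M =
  IsChromaticNumber G χ ×
  (∃ λ κ → Proper G χ κ × deficiency χ κ ≡ M) ×
  (∀ κ → Proper G χ κ → deficiency χ κ ≤ M)

joinEdge : ∀ {n₁ n₂} → SignedGraph n₁ → SignedGraph n₂ →
           Fin (n₁ ℕ.+ n₂) → Fin (n₁ ℕ.+ n₂) → Maybe Sign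
joinEdge {n₁} G₁ G₂ a b with splitAt n₁ a | splitAt n₁ b
... | inj₁ i | inj₁ j = edge G₁ i j
... | inj₂ i | inj₂ j = edge G₂ i j
... | inj₁ _ | inj₂ _ = just pos
... | inj₂ _ | inj₁ _ = just pos

joinSymm : ∀ {n₁ n₂} (G₁ : SignedGraph n₁) (G₂ : SignedGraph n₂) a b →
           joinEdge G₁ G₂ a b ≡ joinEdge G₁ G₂ b a
joinSymm {n₁} G₁ G₂ a b with splitAt n₁ a | splitAt n₁ b
... | inj₁ i | inj₁ j = symm G₁ i j
... | inj₂ i | inj₂ j = symm G₂ i j
... | inj₁ _ | inj₂ _ = refl
... | inj₂ _ | inj₁ _ = refl

joinLoop : ∀ {n₁ n₂} (G₁ : SignedGraph n₁) (G₂ : SignedGraph n₂) a →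
           joinEdge G₁ G₂ a a ≡ nothing
joinLoop {n₁} G₁ G₂ a with splitAt n₁ a
... | inj₁ i = loopless G₁ i
... | inj₂ i = loopless G₂ i

_∨₊_ : ∀ {n₁ n₂} → SignedGraph n₁ → SignedGraph n₂ → SignedGraph (n₁ ℕ.+ n₂)
G₁ ∨₊ G₂ = record
  { edge = joinEdge G₁ G₂ ; symm = joinSymm G₁ G₂ ; loopless = joinLoop G₁ G₂ }

-- In a minimal colouring κ₁ of Σ₁ no colour c is unused together with −c (for c = 0: 0 is used
-- whenever the palette contains it), for otherwise κ₁ would fit into a smaller palette: drop 0,
-- or apply the signed transposition exchanging ±|c| with the largest pair ±k and drop ±k.
-- A colouring κ₂ of Σ₂ of maximum deficiency uses χ₂ − M₂ ≤ M₁ colours, so they can be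
-- renamed injectively into the M₁ colours unused by κ₁. The renamed κ₂ is still proper: positive
-- edges by injectivity, negative ones because its colours contain no antipodal pair. Together
-- with κ₁ it properly colours the positive join, whose cross edges only need the two colour sets
-- to be disjoint. The lower bound holds because Σ₁ is a subgraph of the join.
module Submission where

open import Defs
open import Data.Nat using (ℕ)
open import Data.Integer using (+_; _+_; _-_; _≥_)
open import Data.Nat as ℕ using (zero; suc; _≤_; _<_; _*_; z≤n; s≤s)
import Data.Nat.Properties as ℕ
open import Data.Nat.DivMod
open import Data.Integer as ℤ using (ℤ; -[1+_]; -_; ∣_∣; _≟_)
import Data.Integer.Properties as ℤ
open import Data.Integer.Tactic.RingSolver using (solve-∀)
open import Data.Fin using (Fin; splitAt; _↑ˡ_; inject≤)
open import Data.Fin.Properties using (any?; splitAt-↑ˡ; inject≤-injective)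
open import Data.List using (List; []; _∷_; _++_; length; filter; lookup)
open import Data.List.Properties using (length-++)
open import Data.List.Membership.Propositional using (_∈_; _∉_)
open import Data.List.Membership.Propositional.Properties
  using (∈-++⁺ˡ; ∈-++⁺ʳ; ∈-++⁻; ∈-filter⁺; ∈-filter⁻; ∈-lookup)
open import Data.List.Relation.Unary.Any using (here; there; index)
open import Data.List.Relation.Unary.Any.Properties using (lookup-index)
open import Data.List.Relation.Unary.All as All using ([]; _∷_)
open import Data.List.Relation.Unary.AllPairs using ([]; _∷_)
open import Data.List.Relation.Unary.Unique.Propositional using (Unique)
import Data.List.Relation.Unary.Unique.Propositional.Properties as Unique
open import Data.Maybe using (just)
open import Data.Product using (_×_; _,_; ∃; proj₁; proj₂)
open import Data.Sum using (_⊎_; inj₁; inj₂; [_,_]′)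
open import Function using (_∘_)
open import Function.Definitions using (Injective)
open import Relation.Nullary using (¬_; yes; no; ¬?; contradiction)
open import Relation.Unary using (Pred; Decidable)
open import Relation.Binary.PropositionalEquality

private
  variable
    n n₁ n₂ j k q r s : ℕ
    x : ℤ

∣i∣≡∣j∣⇒i≡j⊎i≡-j : ∀ x y → ∣ x ∣ ≡ ∣ y ∣ → x ≡ y ⊎ x ≡ - y
∣i∣≡∣j∣⇒i≡j⊎i≡-j (+ m)    (+ n)    e = inj₁ (cong +_ e)
∣i∣≡∣j∣⇒i≡j⊎i≡-j (+ m)    -[1+ n ] e = inj₂ (cong +_ e)
∣i∣≡∣j∣⇒i≡j⊎i≡-j -[1+ m ] (+ n)    refl = inj₂ refl
∣i∣≡∣j∣⇒i≡j⊎i≡-j -[1+ m ] -[1+ n ] e = inj₁ (cong -[1+_] (ℕ.suc-injective e))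

∈-pairs⁻ : x ∈ pairs k → 1 ≤ ∣ x ∣ × ∣ x ∣ ≤ k
∈-pairs⁻ {k = suc k} (here refl)         = s≤s z≤n , ℕ.≤-refl
∈-pairs⁻ {k = suc k} (there (here refl)) = s≤s z≤n , ℕ.≤-refl
∈-pairs⁻ {k = suc k} (there (there x∈)) with ∈-pairs⁻ x∈
... | 1≤∣x∣ , ∣x∣≤k = 1≤∣x∣ , ℕ.m≤n⇒m≤1+n ∣x∣≤k

∈-pairs⁺ : 1 ≤ ∣ x ∣ → ∣ x ∣ ≤ k → x ∈ pairs k
∈-pairs⁺ {k = zero}  1≤∣x∣ ∣x∣≤0 = contradiction (ℕ.≤-trans 1≤∣x∣ ∣x∣≤0) λ ()
∈-pairs⁺ {x} {suc k} 1≤∣x∣ ∣x∣≤k with ∣ x ∣ ℕ.≟ suc k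
... | yes ∣x∣≡k with ∣i∣≡∣j∣⇒i≡j⊎i≡-j x (+ suc k) ∣x∣≡k
...   | inj₁ refl = here refl
...   | inj₂ refl = there (here refl)
∈-pairs⁺ 1≤∣x∣ ∣x∣≤k | no ∣x∣≢k = there (there (∈-pairs⁺ 1≤∣x∣ (ℕ.m<1+n⇒m≤n (ℕ.≤∧≢⇒< ∣x∣≤k ∣x∣≢k))))

∈-zeroPart⁻ : r < 2 → x ∈ zeroPart r → x ≡ + 0 × r ≡ 1
∈-zeroPart⁻ {suc zero}    _                   (here refl) = refl , refl
∈-zeroPart⁻ {suc (suc r)} (s≤s (s≤s ())) _

length-zeroPart : r < 2 → length (zeroPart r) ≡ r
length-zeroPart {zero}        _ = refl
length-zeroPart {suc zero}    _ = refl
length-zeroPart {suc (suc r)} (s≤s (s≤s ()))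

length-pairs : ∀ k → length (pairs k) ≡ k * 2
length-pairs zero    = refl
length-pairs (suc k) = cong (suc ∘ suc) (length-pairs k)

length-palette : ∀ s → length (palette s) ≡ s
length-palette s = begin
  length (zeroPart (s % 2) ++ pairs (s / 2))             ≡⟨ length-++ (zeroPart (s % 2)) ⟩
  length (zeroPart (s % 2)) ℕ.+ length (pairs (s / 2))   ≡⟨ cong₂ ℕ._+_ (length-zeroPart (m%n<n s 2)) (length-pairs (s / 2)) ⟩
  s % 2 ℕ.+ s / 2 * 2                                    ≡⟨ m≡m%n+[m/n]*n s 2 ⟨
  s                                                      ∎
  where open ≡-Reasoning

pairs-unique : ∀ k → Unique (pairs k)
pairs-unique zero    = []
pairs-unique (suc k) =
  ((λ ()) ∷ All.tabulate (fresh (+ suc k) refl)) ∷ All.tabulate (fresh -[1+ k ] refl) ∷ pairs-unique k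
  where
  fresh : ∀ x → ∣ x ∣ ≡ suc k → ∀ {y} → y ∈ pairs k → x ≢ y
  fresh x ∣x∣≡1+k y∈ refl = ℕ.<-irrefl ∣x∣≡1+k (s≤s (proj₂ (∈-pairs⁻ y∈)))

palette-unique : ∀ s → Unique (palette s)
palette-unique s = Unique.++⁺ (zeroPart-unique (s % 2)) (pairs-unique (s / 2)) disjoint
  where
  zeroPart-unique : ∀ r → Unique (zeroPart r)
  zeroPart-unique zero    = []
  zeroPart-unique (suc r) = [] ∷ []
  disjoint : ¬ (x ∈ zeroPart (s % 2) × x ∈ pairs (s / 2))
  disjoint (x∈0 , x∈pairs) with ∈-zeroPart⁻ (m%n<n s 2) x∈0 | proj₁ (∈-pairs⁻ x∈pairs)
  ... | refl , _ | ()

divMod-2 : ∀ s → ∃ λ r → ∃ λ q → r < 2 × s ≡ r ℕ.+ q * 2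
divMod-2 s = s % 2 , s / 2 , m%n<n s 2 , m≡m%n+[m/n]*n s 2

palette-r+q*2 : r < 2 → palette (r ℕ.+ q * 2) ≡ zeroPart r ++ pairs q
palette-r+q*2 {r} {q} r<2 = cong₂ (λ a b → zeroPart a ++ pairs b) [r+q*2]%2≡r [r+q*2]/2≡q
  where
  [r+q*2]%2≡r : (r ℕ.+ q * 2) % 2 ≡ r
  [r+q*2]%2≡r = trans ([m+kn]%n≡m%n r q 2) (m<n⇒m%n≡m r<2)
  [r+q*2]/2≡q : (r ℕ.+ q * 2) / 2 ≡ q
  [r+q*2]/2≡q = begin
    (r ℕ.+ q * 2) / 2       ≡⟨ +-distrib-/ r (q * 2) (subst (_< 2) (sym r%2+q*2%2≡r) r<2) ⟩
    r / 2 ℕ.+ q * 2 / 2     ≡⟨ cong₂ ℕ._+_ (m<n⇒m/n≡0 r<2) (m*n/n≡m q 2) ⟩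
    q                       ∎
    where
    open ≡-Reasoning
    r%2+q*2%2≡r : r % 2 ℕ.+ q * 2 % 2 ≡ r
    r%2+q*2%2≡r = trans (cong₂ ℕ._+_ (m<n⇒m%n≡m r<2) (m*n%n≡0 q 2)) (ℕ.+-identityʳ r)

∈-palette⁻ : r < 2 → x ∈ palette (r ℕ.+ q * 2) → x ∈ zeroPart r ⊎ x ∈ pairs q
∈-palette⁻ {r} r<2 x∈ = ∈-++⁻ (zeroPart r) (subst (_ ∈_) (palette-r+q*2 r<2) x∈)

∈-palette⁺ : r < 2 → x ∈ zeroPart r ⊎ x ∈ pairs q → x ∈ palette (r ℕ.+ q * 2)
∈-palette⁺ {r} r<2 x∈ = subst (_ ∈_) (sym (palette-r+q*2 r<2)) ([ ∈-++⁺ˡ , ∈-++⁺ʳ (zeroPart r) ]′ x∈)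

module _ (j k : ℕ) where

  transpose : ℕ → ℕ
  transpose n with n ℕ.≟ j | n ℕ.≟ k
  ... | yes _ | _     = k
  ... | no _  | yes _ = j
  ... | no _  | no _  = n

  data TransposeView (n : ℕ) : ℕ → Set where
    at-left   : n ≡ j → TransposeView n k
    at-right  : n ≢ j → n ≡ k → TransposeView n j
    elsewhere : n ≢ j → n ≢ k → TransposeView n n

  transpose-view : ∀ n → TransposeView n (transpose n)
  transpose-view n with n ℕ.≟ j | n ℕ.≟ k
  ... | yes n≡j | _       = at-left n≡j
  ... | no n≢j  | yes n≡k = at-right n≢j n≡k
  ... | no n≢j  | no n≢k  = elsewhere n≢j n≢k

  transpose-left : transpose j ≡ k
  transpose-left with transpose j | transpose-view j
  ... | _ | at-left _       = refl
  ... | _ | at-right j≢j _  = contradiction refl j≢j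
  ... | _ | elsewhere j≢j _ = contradiction refl j≢j

  transpose-right : transpose k ≡ j
  transpose-right with transpose k | transpose-view k
  ... | _ | at-left k≡j     = k≡j
  ... | _ | at-right _ _    = refl
  ... | _ | elsewhere _ k≢k = contradiction refl k≢k

  transpose-fixed : n ≢ j → n ≢ k → transpose n ≡ n
  transpose-fixed {n} n≢j n≢k with transpose n | transpose-view n
  ... | _ | at-left n≡j    = contradiction n≡j n≢j
  ... | _ | at-right _ n≡k = contradiction n≡k n≢k
  ... | _ | elsewhere _ _  = refl

  transpose-involutive : ∀ n → transpose (transpose n) ≡ n
  transpose-involutive n with transpose n | transpose-view n
  ... | _ | at-left refl        = transpose-right
  ... | _ | at-right _ refl     = transpose-left
  ... | _ | elsewhere n≢j n≢k   = transpose-fixed n≢j n≢k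

  signedTranspose : ℤ → ℤ
  signedTranspose (+ n)    = + transpose n
  signedTranspose -[1+ n ] = - + transpose (suc n)

  ∣signedTranspose∣ : ∀ x → ∣ signedTranspose x ∣ ≡ transpose ∣ x ∣
  ∣signedTranspose∣ (+ n)    = refl
  ∣signedTranspose∣ -[1+ n ] = ℤ.∣-i∣≡∣i∣ (+ transpose (suc n))

transpose-≤ : 1 ≤ j → j ≤ suc q → 1 ≤ n → n ≤ suc q → n ≢ j →
              1 ≤ transpose j (suc q) n × transpose j (suc q) n ≤ q
transpose-≤ {j} {q} {n} 1≤j j≤1+q 1≤n n≤1+q n≢j with transpose j (suc q) n | transpose-view j (suc q) n
... | _ | at-left n≡j        = contradiction n≡j n≢j
... | _ | at-right _ refl    = 1≤j , ℕ.m<1+n⇒m≤n (ℕ.≤∧≢⇒< j≤1+q (n≢j ∘ sym))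
... | _ | elsewhere _ n≢1+q  = 1≤n , ℕ.m<1+n⇒m≤n (ℕ.≤∧≢⇒< n≤1+q n≢1+q)

module _ {j k : ℕ} (1≤j : 1 ≤ j) (1≤k : 1 ≤ k) where

  signedTranspose-zero : signedTranspose j k (+ 0) ≡ + 0
  signedTranspose-zero = cong +_ (transpose-fixed j k (λ 0≡j → ℕ.<-irrefl 0≡j 1≤j) (λ 0≡k → ℕ.<-irrefl 0≡k 1≤k))

  signedTranspose-odd : ∀ x → signedTranspose j k (- x) ≡ - signedTranspose j k x
  signedTranspose-odd (+ zero)  = trans signedTranspose-zero (cong -_ (sym signedTranspose-zero))
  signedTranspose-odd (+ suc n) = refl
  signedTranspose-odd -[1+ n ]  = sym (ℤ.neg-involutive _)

  signedTranspose-involutive : ∀ x → signedTranspose j k (signedTranspose j k x) ≡ x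
  signedTranspose-involutive (+ n)    = cong +_ (transpose-involutive j k n)
  signedTranspose-involutive -[1+ n ] = begin
    signedTranspose j k (- + transpose j k (suc n))   ≡⟨ signedTranspose-odd (+ transpose j k (suc n)) ⟩
    - + transpose j k (transpose j k (suc n))         ≡⟨ cong (-_ ∘ +_) (transpose-involutive j k (suc n)) ⟩
    -[1+ n ]                                          ∎
    where open ≡-Reasoning

  signedTranspose-injective : Injective _≡_ _≡_ (signedTranspose j k)
  signedTranspose-injective {x} {y} eq = begin
    x                                           ≡⟨ signedTranspose-involutive x ⟨
    signedTranspose j k (signedTranspose j k x) ≡⟨ cong (signedTranspose j k) eq ⟩
    signedTranspose j k (signedTranspose j k y) ≡⟨ signedTranspose-involutive y ⟩
    y                                           ∎
    where open ≡-Reasoning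

signedTranspose-∈-pairs : 1 ≤ j → j ≤ suc q → x ∈ pairs (suc q) → ∣ x ∣ ≢ j → signedTranspose j (suc q) x ∈ pairs q
signedTranspose-∈-pairs {j} {q} {x} 1≤j j≤1+q x∈ ∣x∣≢j with ∈-pairs⁻ x∈
... | 1≤∣x∣ , ∣x∣≤1+q with transpose-≤ 1≤j j≤1+q 1≤∣x∣ ∣x∣≤1+q ∣x∣≢j
...   | 1≤t , t≤q = ∈-pairs⁺ (subst (1 ≤_) t≡∣tx∣ 1≤t) (subst (_≤ q) t≡∣tx∣ t≤q)
  where
  t≡∣tx∣ : transpose j (suc q) ∣ x ∣ ≡ ∣ signedTranspose j (suc q) x ∣
  t≡∣tx∣ = sym (∣signedTranspose∣ j (suc q) x)

ProperEdges : SignedGraph n → (Fin n → ℤ) → Set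
ProperEdges G κ = ∀ a b σ → edge G a b ≡ just σ → κ a ≢ act σ (κ b)

Avoids : (Fin n → ℤ) → ℤ → Set
Avoids κ c = ∀ v → κ v ≢ c

act-commute : ∀ {f : ℤ → ℤ} → (∀ x → f (- x) ≡ - f x) → ∀ σ x → f (act σ x) ≡ act σ (f x)
act-commute odd pos x = refl
act-commute odd neg x = odd x

ProperEdges-∘ : ∀ (G : SignedGraph n) {κ} {f : ℤ → ℤ} → Injective _≡_ _≡_ f → (∀ x → f (- x) ≡ - f x) →
                ProperEdges G κ → ProperEdges G (f ∘ κ)
ProperEdges-∘ G {κ} f-inj f-odd edges a b σ ab eq =
  edges a b σ ab (f-inj (trans eq (sym (act-commute f-odd σ (κ b)))))

Proper-avoiding-zero : ∀ (G : SignedGraph n) {κ} → Proper G (1 ℕ.+ q * 2) κ → Avoids κ (+ 0) → Proper G (q * 2) κ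
Proper-avoiding-zero {q = q} G {κ} (pal , edges) avoid = recolour , edges
  where
  recolour : ∀ v → κ v ∈ palette (q * 2)
  recolour v with ∈-palette⁻ {q = q} (s≤s (s≤s z≤n)) (pal v)
  ... | inj₁ (here κv≡0) = contradiction κv≡0 (avoid v)
  ... | inj₂ κv∈pairs    = ∈-palette⁺ {0} (s≤s z≤n) (inj₂ κv∈pairs)

Proper-transposed : ∀ (G : SignedGraph n) {κ} → r < 2 → 1 ≤ j → j ≤ suc q →
                    Proper G (r ℕ.+ suc q * 2) κ → (∀ v → ∣ κ v ∣ ≢ j) →
                    Proper G (r ℕ.+ q * 2) (signedTranspose j (suc q) ∘ κ)
Proper-transposed {r = r} {j} {q} G {κ} r<2 1≤j j≤1+q (pal , edges) avoid =
  recolour , ProperEdges-∘ G (signedTranspose-injective 1≤j (s≤s z≤n)) (signedTranspose-odd 1≤j (s≤s z≤n)) edges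
  where
  g : ℤ → ℤ
  g = signedTranspose j (suc q)
  recolour : ∀ v → g (κ v) ∈ palette (r ℕ.+ q * 2)
  recolour v with ∈-palette⁻ {q = suc q} r<2 (pal v)
  ... | inj₁ κv∈0 = ∈-palette⁺ {q = q} r<2 (inj₁ (subst (_∈ zeroPart r) (sym gκv≡κv) κv∈0))
    where
    κv≡0 : κ v ≡ + 0
    κv≡0 = proj₁ (∈-zeroPart⁻ r<2 κv∈0)
    gκv≡κv : g (κ v) ≡ κ v
    gκv≡κv = trans (cong g κv≡0) (trans (signedTranspose-zero 1≤j (s≤s z≤n)) (sym κv≡0))
  ... | inj₂ κv∈pairs = ∈-palette⁺ r<2 (inj₂ (signedTranspose-∈-pairs 1≤j j≤1+q κv∈pairs (avoid v)))

Avoids-±-pairs⇒Colorable< : ∀ (G : SignedGraph n) {κ} → r < 2 → x ∈ pairs q → Proper G (r ℕ.+ q * 2) κ →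
                            Avoids κ x → Avoids κ (- x) → ∃ λ t → t < r ℕ.+ q * 2 × Colorable G t
Avoids-±-pairs⇒Colorable< {r = r} {x} {suc q} G {κ} r<2 x∈ proper avoid-x avoid-−x =
  r ℕ.+ q * 2 , ℕ.+-monoʳ-< r (ℕ.*-monoˡ-< 2 (ℕ.n<1+n q)) ,
  _ , Proper-transposed G r<2 (proj₁ (∈-pairs⁻ x∈)) (proj₂ (∈-pairs⁻ x∈)) proper avoid-∣x∣
  where
  avoid-∣x∣ : ∀ v → ∣ κ v ∣ ≢ ∣ x ∣
  avoid-∣x∣ v ∣κv∣≡∣x∣ = [ avoid-x v , avoid-−x v ]′ (∣i∣≡∣j∣⇒i≡j⊎i≡-j (κ v) x ∣κv∣≡∣x∣)

Avoids-±⇒Colorable< : ∀ (G : SignedGraph n) {κ} → Proper G s κ → x ∈ palette s →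
                      Avoids κ x → Avoids κ (- x) → ∃ λ t → t < s × Colorable G t
Avoids-±⇒Colorable< {s = s} G {κ} proper x∈ avoid-x avoid-−x with divMod-2 s
... | r , q , r<2 , refl with ∈-palette⁻ {q = q} r<2 x∈
...   | inj₂ x∈pairs = Avoids-±-pairs⇒Colorable< G r<2 x∈pairs proper avoid-x avoid-−x
...   | inj₁ x∈0 with ∈-zeroPart⁻ r<2 x∈0
...     | refl , refl = q * 2 , ℕ.n<1+n (q * 2) , κ , Proper-avoiding-zero {q = q} G proper avoid-x

used? : (κ : Fin n → ℤ) → Decidable (λ c → ∃ λ v → κ v ≡ c)
used? κ c = any? (λ v → κ v ≟ c)

usedColours unusedColours : ℕ → (Fin n → ℤ) → List ℤ
usedColours   s κ = filter (used? κ) (palette s)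
unusedColours s κ = filter (¬? ∘ used? κ) (palette s)

∈-unusedColours⁻ : ∀ {κ : Fin n → ℤ} {c} → c ∈ unusedColours s κ → c ∈ palette s × Avoids κ c
∈-unusedColours⁻ {s = s} {κ = κ} c∈ with ∈-filter⁻ (¬? ∘ used? κ) {xs = palette s} c∈
... | c∈palette , unused = c∈palette , λ v κv≡c → unused (v , κv≡c)

AntipodalFree : List ℤ → Set
AntipodalFree xs = ∀ {x} → x ∈ xs → - x ∉ xs

unusedColours-antipodalFree : ∀ {χ} (G : SignedGraph n) {κ} → IsChromaticNumber G χ → Proper G χ κ →
                              AntipodalFree (unusedColours χ κ)
unusedColours-antipodalFree {χ = χ} G {κ} (_ , χ-minimal) proper x∈ −x∈
  with ∈-unusedColours⁻ {s = χ} {κ} x∈ | ∈-unusedColours⁻ {s = χ} {κ} −x∈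
... | x∈palette , avoid-x | _ , avoid-−x
  with Avoids-±⇒Colorable< G proper x∈palette avoid-x avoid-−x
...   | t , t<χ , colorable = χ-minimal t t<χ colorable

length-filter+length-filter-∁ : ∀ {a p} {A : Set a} {P : Pred A p} (P? : Decidable P) xs →
                                length (filter P? xs) ℕ.+ length (filter (¬? ∘ P?) xs) ≡ length xs
length-filter+length-filter-∁ P? []       = refl
length-filter+length-filter-∁ P? (x ∷ xs) with P? x
... | yes _ = cong suc (length-filter+length-filter-∁ P? xs)
... | no _  = trans (ℕ.+-suc _ _) (cong suc (length-filter+length-filter-∁ P? xs))

length-usedColours+deficiency : ∀ s (κ : Fin n → ℤ) → length (usedColours s κ) ℕ.+ deficiency s κ ≡ s
length-usedColours+deficiency s κ = trans (length-filter+length-filter-∁ (used? κ) (palette s)) (length-palette s)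

lookup-injective : ∀ {a} {A : Set a} {xs : List A} → Unique xs → ∀ i j → lookup xs i ≡ lookup xs j → i ≡ j
lookup-injective (_ ∷ _)       Fin.zero    Fin.zero    _  = refl
lookup-injective (x∉ ∷ _)      Fin.zero    (Fin.suc j) eq = contradiction eq (All.lookup x∉ (∈-lookup j))
lookup-injective (x∉ ∷ _)      (Fin.suc i) Fin.zero    eq = contradiction (sym eq) (All.lookup x∉ (∈-lookup i))
lookup-injective (_ ∷ unique)  (Fin.suc i) (Fin.suc j) eq = cong Fin.suc (lookup-injective unique i j eq)

module Embedding {a} {A : Set a} {xs ys : List A} (len≤ : length xs ≤ length ys) where

  embed : ∀ {x} → x ∈ xs → A
  embed x∈ = lookup ys (inject≤ (index x∈) len≤)

  embed-∈ : ∀ {x} (x∈ : x ∈ xs) → embed x∈ ∈ ys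
  embed-∈ x∈ = ∈-lookup (inject≤ (index x∈) len≤)

  embed-injective : Unique ys → ∀ {x y} (x∈ : x ∈ xs) (y∈ : y ∈ xs) → embed x∈ ≡ embed y∈ → x ≡ y
  embed-injective unique x∈ y∈ eq = begin
    _                        ≡⟨ lookup-index x∈ ⟩
    lookup xs (index x∈)     ≡⟨ cong (lookup xs) (inject≤-injective len≤ len≤ _ _ (lookup-injective unique _ _ eq)) ⟩
    lookup xs (index y∈)     ≡⟨ lookup-index y∈ ⟨
    _                        ∎
    where open ≡-Reasoning

+c≥+c++d-+m-+n⇒d≤m+n : ∀ c d m n → + c ≥ + c + + d - + m - + n → d ≤ m ℕ.+ n
+c≥+c++d-+m-+n⇒d≤m+n c d m n hyp = ℕ.+-cancelˡ-≤ c d (m ℕ.+ n) (ℤ.drop‿+≤+ (begin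
  + (c ℕ.+ d)                         ≡⟨ ℤ.pos-+ c d ⟩
  + c + + d                           ≡⟨ cancel (+ c) (+ d) (+ m) (+ n) ⟩
  + c + + d - + m - + n + (+ m + + n) ≤⟨ ℤ.+-monoˡ-≤ (+ m + + n) hyp ⟩
  + c + (+ m + + n)                   ≡⟨ cong (_+_ (+ c)) (ℤ.pos-+ m n) ⟨
  + c + + (m ℕ.+ n)                   ≡⟨ ℤ.pos-+ c (m ℕ.+ n) ⟨
  + (c ℕ.+ (m ℕ.+ n))                 ∎))
  where
  open ℤ.≤-Reasoning
  cancel : ∀ a b x y → a + b ≡ a + b - x - y + (x + y)
  cancel = solve-∀

joinColouring : (Fin n₁ → ℤ) → (Fin n₂ → ℤ) → Fin (n₁ ℕ.+ n₂) → ℤ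
joinColouring {n₁} κ₁ κ₂ = [ κ₁ , κ₂ ]′ ∘ splitAt n₁

Proper-∨₊ : ∀ (G₁ : SignedGraph n₁) (G₂ : SignedGraph n₂) {κ₁ κ₂} → Proper G₁ s κ₁ → Proper G₂ s κ₂ →
            (∀ v w → κ₁ v ≢ κ₂ w) → Proper (G₁ ∨₊ G₂) s (joinColouring κ₁ κ₂)
Proper-∨₊ {n₁} {s = s} G₁ G₂ {κ₁} {κ₂} (pal₁ , edges₁) (pal₂ , edges₂) disjoint = pal , edges
  where
  pal : ∀ a → joinColouring κ₁ κ₂ a ∈ palette s
  pal a with splitAt n₁ a
  ... | inj₁ v = pal₁ v
  ... | inj₂ w = pal₂ w
  edges : ProperEdges (G₁ ∨₊ G₂) (joinColouring κ₁ κ₂)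
  edges a b σ ab with splitAt n₁ a | splitAt n₁ b
  edges a b σ ab    | inj₁ v | inj₁ v′ = edges₁ v v′ σ ab
  edges a b σ ab    | inj₂ w | inj₂ w′ = edges₂ w w′ σ ab
  edges a b .pos refl | inj₁ v | inj₂ w = disjoint v w
  edges a b .pos refl | inj₂ w | inj₁ v = disjoint v w ∘ sym

Colorable-∨₊⇒Colorableˡ : ∀ (G₁ : SignedGraph n₁) (G₂ : SignedGraph n₂) → Colorable (G₁ ∨₊ G₂) s → Colorable G₁ s
Colorable-∨₊⇒Colorableˡ {n₁} {n₂} G₁ G₂ (κ , pal , edges) =
  κ ∘ (_↑ˡ n₂) , pal ∘ (_↑ˡ n₂) , λ a b σ ab → edges (a ↑ˡ n₂) (b ↑ˡ n₂) σ (trans (joinEdge-↑ˡ a b) ab)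
  where
  joinEdge-↑ˡ : ∀ a b → joinEdge G₁ G₂ (a ↑ˡ n₂) (b ↑ˡ n₂) ≡ edge G₁ a b
  joinEdge-↑ˡ a b rewrite splitAt-↑ˡ n₁ a n₂ | splitAt-↑ˡ n₁ b n₂ = refl

ProperEdges-recolour : ∀ (G : SignedGraph n) {κ f : Fin n → ℤ} {xs} → ProperEdges G κ →
                       (∀ v w → f v ≡ f w → κ v ≡ κ w) → (∀ v → f v ∈ xs) → AntipodalFree xs → ProperEdges G f
ProperEdges-recolour G edges f-reflects f∈ antipodalFree a b pos ab eq = edges a b pos ab (f-reflects a b eq)
ProperEdges-recolour G edges f-reflects f∈ antipodalFree a b neg ab eq =
  antipodalFree (f∈ b) (subst (_∈ _) eq (f∈ a))

length-usedColours≤length-unusedColours : ∀ {χ₁ χ₂ M₁ M₂} (κ₁ : Fin n₁ → ℤ) (κ₂ : Fin n₂ → ℤ) →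
  deficiency χ₁ κ₁ ≡ M₁ → deficiency χ₂ κ₂ ≡ M₂ → χ₂ ≤ M₁ ℕ.+ M₂ →
  length (usedColours χ₂ κ₂) ≤ length (unusedColours χ₁ κ₁)
length-usedColours≤length-unusedColours {χ₁ = χ₁} {χ₂} {M₁} {M₂} κ₁ κ₂ deficiency₁ deficiency₂ χ₂≤M₁+M₂ =
  ℕ.+-cancelʳ-≤ M₂ _ _ (begin
    length (usedColours χ₂ κ₂) ℕ.+ M₂              ≡⟨ cong (_ ℕ.+_) deficiency₂ ⟨
    length (usedColours χ₂ κ₂) ℕ.+ deficiency χ₂ κ₂ ≡⟨ length-usedColours+deficiency χ₂ κ₂ ⟩
    χ₂                                             ≤⟨ χ₂≤M₁+M₂ ⟩
    M₁ ℕ.+ M₂                                      ≡⟨ cong (ℕ._+ M₂) deficiency₁ ⟨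
    length (unusedColours χ₁ κ₁) ℕ.+ M₂            ∎)
  where open ℕ.≤-Reasoning

Proper-into-unusedColours : ∀ {χ₁ χ₂} (G₁ : SignedGraph n₁) (G₂ : SignedGraph n₂) {κ₁ κ₂} →
  IsChromaticNumber G₁ χ₁ → Proper G₁ χ₁ κ₁ → Proper G₂ χ₂ κ₂ →
  length (usedColours χ₂ κ₂) ≤ length (unusedColours χ₁ κ₁) →
  ∃ λ κ → Proper G₂ χ₁ κ × (∀ v w → κ₁ v ≢ κ w)
Proper-into-unusedColours {n₂ = n₂} {χ₁ = χ₁} {χ₂} G₁ G₂ {κ₁} {κ₂} χ₁-chromatic proper₁ (pal₂ , edges₂) used₂≤unused₁ =
  κ , (proj₁ ∘ unused , edges) , λ v w → proj₂ (unused w) v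
  where
  open Embedding {xs = usedColours χ₂ κ₂} {ys = unusedColours χ₁ κ₁} used₂≤unused₁
  κ₂-used : ∀ v → κ₂ v ∈ usedColours χ₂ κ₂
  κ₂-used v = ∈-filter⁺ (used? κ₂) {xs = palette χ₂} (pal₂ v) (v , refl)
  κ : Fin n₂ → ℤ
  κ = embed ∘ κ₂-used
  unused : ∀ v → κ v ∈ palette χ₁ × Avoids κ₁ (κ v)
  unused v = ∈-unusedColours⁻ {s = χ₁} {κ₁} (embed-∈ (κ₂-used v))
  edges : ProperEdges G₂ κ
  edges = ProperEdges-recolour G₂ edges₂
    (λ v w → embed-injective (Unique.filter⁺ (¬? ∘ used? κ₁) (palette-unique χ₁)) (κ₂-used v) (κ₂-used w))
    (embed-∈ ∘ κ₂-used) (unusedColours-antipodalFree G₁ χ₁-chromatic proper₁)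

lemma4 : ∀ {n₁ n₂} (Σ₁ : SignedGraph n₁) (Σ₂ : SignedGraph n₂) (χ₁ χ₂ M₁ M₂ : ℕ) →
    IsChromaticNumber Σ₁ χ₁ → IsChromaticNumber Σ₂ χ₂ →
    IsMaxDeficiency Σ₁ χ₁ M₁ → IsMaxDeficiency Σ₂ χ₂ M₂ →
    + χ₁ ≥ + χ₁ + + χ₂ - + M₁ - + M₂ →
    IsChromaticNumber (Σ₁ ∨₊ Σ₂) χ₁
lemma4 Σ₁ Σ₂ χ₁ χ₂ M₁ M₂ χ₁-chromatic _ (_ , (κ₁ , proper₁ , deficiency₁) , _) (_ , (κ₂ , proper₂ , deficiency₂) , _) budget
  with Proper-into-unusedColours {χ₁ = χ₁} {χ₂} Σ₁ Σ₂ χ₁-chromatic proper₁ proper₂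
         (length-usedColours≤length-unusedColours {χ₁ = χ₁} {χ₂} κ₁ κ₂ deficiency₁ deficiency₂ (+c≥+c++d-+m-+n⇒d≤m+n χ₁ χ₂ M₁ M₂ budget))
... | κ , proper , disjoint =
  (joinColouring κ₁ κ , Proper-∨₊ {s = χ₁} Σ₁ Σ₂ proper₁ proper disjoint) ,
  λ t t<χ₁ → proj₂ χ₁-chromatic t t<χ₁ ∘ Colorable-∨₊⇒Colorableˡ {s = t} Σ₁ Σ₂
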